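{- Let $(V,*)$ be a travel groupoid and for $u,v\in V$ let $V_{u,v}=\{w\in V\mid u*w=v\}$. Then the following are equivalent: (a) $(V,*)$ is smooth, i.e. for all $u,v,w\in V$, if $u*v=u*w$ then $u*(v*w)=u*v$; (b) for all $u,v,x,y\in V$, if $x,y\in V_{u,v}$ then $x*y\in V_{u,v}$; (c) for all $u,v,x,y,z\in V$, if $x,y\in V_{u,v}$ and $x\in V_{y,z}$, then $z\in V_{u,v}$.
   Context: A travel groupoid is a nonempty set $V$ with a binary operation $*$ satisfying (t1) $(u*v)*u=u$ for all $u,v\in V$, and (t2) for all $u,v\in V$, if $(u*v)*v=u$ then $u=v$. -}

module Defs where

open import Level using (Level; suc; _⊔_)
open import Relation.Binary.PropositionalEquality using (_≡_)

record TravelGroupoid (a : Level) : Set (suc a) where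
  field
    V        : Set a
    _*_      : V → V → V
    nonempty : V
    t1       : ∀ u v → (u * v) * u ≡ u
    t2       : ∀ u v → (u * v) * v ≡ u → u ≡ v

module _ {a : Level} (G : TravelGroupoid a) where
  open TravelGroupoid G

  Vuv : V → V → V → Set a
  Vuv u v w = u * w ≡ v

  Smooth : Set a
  Smooth = ∀ u v w → u * v ≡ u * w → u * (v * w) ≡ u * v

  ConditionB : Set a
  ConditionB = ∀ u v x y → Vuv u v x → Vuv u v y → Vuv u v (x * y)

  ConditionC : Set a
  ConditionC = ∀ u v x y z → Vuv u v x → Vuv u v y → Vuv y z x → Vuv u v z

module Submission where

-- All four implications are direct manipulations of the defining equations.

open import Defs
open import Level using (Level)
open import Function.Bundles using (_⇔_; mk⇔)
open import Data.Product using (_×_; _,_)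
open import Relation.Binary.PropositionalEquality using (_≡_; refl; sym; trans; subst)

module _ {a : Level} (G : TravelGroupoid a) where
  open TravelGroupoid G

  same-target : ∀ {u v x y} → Vuv G u v x → Vuv G u v y → u * x ≡ u * y
  same-target hx hy = trans hx (sym hy)

  smooth⇒conditionB : Smooth G → ConditionB G
  smooth⇒conditionB smooth u v x y hx hy =
    trans (smooth u x y (same-target hx hy)) hx

  -- (b) ⇒ (a): v and w both lie in V_{u, u*v}, so v * w does too.
  conditionB⇒smooth : ConditionB G → Smooth G
  conditionB⇒smooth closed u v w e = closed u (u * v) v w refl (sym e)

  conditionB⇒conditionC : ConditionB G → ConditionC G
  conditionB⇒conditionC closed u v x y z hx hy y*x≡z =
    subst (Vuv G u v) y*x≡z (closed u v y x hy hx)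

  -- (c) ⇒ (b): y ∈ V_{x, x*y} holds by definition, so (c), applied with the
  -- roles of x and y swapped, transfers membership in V_{u,v} to x * y.
  conditionC⇒conditionB : ConditionC G → ConditionB G
  conditionC⇒conditionB transfer u v x y hx hy = transfer u v y x (x * y) hy hx refl

proposition4p6 : ∀ {a : Level} (G : TravelGroupoid a) →
    (Smooth G ⇔ ConditionB G) × (ConditionB G ⇔ ConditionC G)
proposition4p6 G =
  mk⇔ (smooth⇒conditionB G) (conditionB⇒smooth G) ,
  mk⇔ (conditionB⇒conditionC G) (conditionC⇒conditionB G)
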